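{- Let $F$ be a graph, $(H,\sigma)$ an $F$-coloured graph and $c: V(F)\to\mathbb{Z}_{>0}$ an injection. If some linear combination of the equations in $\mathrm{Eq}(H,\sigma,c)$ is convex, then some single cycle-equation of $H$ (with respect to $\sigma$ and $c$) is convex.
   Context: An $F$-coloured graph is a pair $(H,\sigma)$ with $\sigma: V(H)\to V(F)$ a homomorphism. Introduce one variable $x_e$ for each edge $e$ of $H$. For a cycle $v_1v_2\dots v_\ell$ of $H$ its cycle-equation is $\sum_{i=1}^{\ell}(c(\sigma(v_{i+1}))-c(\sigma(v_i)))\,x_{v_iv_{i+1}}=0$, with indices modulo $\ell$ (so $v_{\ell+1}=v_1$). $\mathrm{Eq}(H,\sigma,c)$ is the system of the cycle-equations of all cycles of $H$. A linear combination of these yields an equation $\sum_{e\in E(H)}a_ex_e=0$; such an equation is convex if exactly one coefficient $a_e$ is negative. -}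

module Defs where

open import Data.Nat as ℕ using (ℕ; zero; suc; _<_)
open import Data.Nat.DivMod using (_%_; m%n<n)
open import Data.Fin as Fin using (Fin; toℕ; fromℕ<; _≟_)
open import Data.Integer as ℤ using (ℤ; 0ℤ; 1ℤ; +_; _*_; _-_)
open import Data.List using (List; []; _∷_; foldr; map; allFin)
open import Data.Product using (Σ; _×_; _,_; ∃; ∃-syntax)
open import Data.Sum using (_⊎_)
open import Relation.Binary.PropositionalEquality using (_≡_)
open import Relation.Nullary using (¬_; Dec; yes; no)
open import Relation.Nullary.Decidable using (_×-dec_; _⊎-dec_)
open import Function.Definitions using (Injective)

record Graph (n : ℕ) : Set₁ where
  field
    E      : Fin n → Fin n → Set
    sym    : ∀ {u v} → E u v → E v u
    irrefl : ∀ {u} → ¬ E u u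
open Graph public

IsHom : ∀ {n m} → Graph n → Graph m → (Fin n → Fin m) → Set
IsHom H F σ = ∀ {u v} → E H u v → E F (σ u) (σ v)

next : ∀ {ℓ} → Fin (suc ℓ) → Fin (suc ℓ)
next {ℓ} i = fromℕ< (m%n<n (suc (toℕ i)) (suc ℓ))

-- A cycle v₁ v₂ … v_ℓ of H (ℓ ≥ 3, distinct vertices, consecutive ones
-- adjacent, including v_ℓ v₁).  Here ℓ = suc len.
record Cycle {n : ℕ} (H : Graph n) : Set where
  field
    len    : ℕ
    len≥3  : 2 ℕ.≤ len
    vtx    : Fin (suc len) → Fin n
    inj    : Injective _≡_ _≡_ vtx
    adj    : ∀ i → E H (vtx i) (vtx (next i))
open Cycle public

Σℤ : List ℤ → ℤ
Σℤ = foldr ℤ._+_ 0ℤ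

[_,_≐_,_] : ∀ {n} → Fin n → Fin n → Fin n → Fin n → ℤ
[ x , y ≐ a , b ] with ((x ≟ a) ×-dec (y ≟ b)) ⊎-dec ((x ≟ b) ×-dec (y ≟ a))
... | yes _ = 1ℤ
... | no  _ = 0ℤ

col : ∀ {n m} → (Fin n → Fin m) → (Fin m → ℕ) → Fin n → ℤ
col σ c v = + c (σ v)

-- coefficient of the variable x_{ab} in the cycle-equation of C:
--   Σ_i (c(σ v_{i+1}) - c(σ v_i)) · [ v_i v_{i+1} = ab ]
cycCoeff : ∀ {n m} {H : Graph n} → (Fin n → Fin m) → (Fin m → ℕ)
         → Cycle H → Fin n → Fin n → ℤ
cycCoeff σ c C a b =
  Σℤ (map (λ i → [ vtx C i , vtx C (next i) ≐ a , b ]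
                 * (col σ c (vtx C (next i)) - col σ c (vtx C i)))
          (allFin (suc (len C))))

LinComb : ∀ {n} → Graph n → Set
LinComb H = List (ℤ × Cycle H)

combCoeff : ∀ {n m} {H : Graph n} → (Fin n → Fin m) → (Fin m → ℕ)
          → LinComb H → Fin n → Fin n → ℤ
combCoeff σ c L a b = Σℤ (map (λ { (λ' , C) → λ' * cycCoeff σ c C a b }) L)

-- Edges of H are represented by ordered pairs (a , b) with a < b.
IsEdge : ∀ {n} → Graph n → Fin n → Fin n → Set
IsEdge H a b = (a Fin.< b) × E H a b

Convex : ∀ {n} → (H : Graph n) → (Fin n → Fin n → ℤ) → Set
Convex {n} H coeff =
  Σ (Fin n × Fin n) λ { (a , b) → IsEdge H a b × coeff a b ℤ.< 0ℤ
    × (∀ a' b' → IsEdge H a' b' → coeff a' b' ℤ.< 0ℤ → (a' , b') ≡ (a , b)) }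

{-# OPTIONS --safe #-}

-- Write P = c ∘ σ and let A be the coefficients of the combined equation.
-- A cycle C carries a unit circulation φ_C along its arcs, and the coefficient
-- of x_uw in its cycle-equation is φ_C(u,w) · (P w − P u).  Hence
-- A(u,w) = φ(u,w) · (P w − P u) for the circulation φ = Σ λ_C φ_C.  If st, with
-- P s < P t, is the only edge with A < 0, then φ(s,t) < 0, while for every
-- arc (u,w) with u ≠ t, φ(u,w) > 0 forces P u < P w.  Since φ is conserved,
-- we can walk from s along arcs of positive flow, strictly climbing in P, until
-- we reach t; the edge ts closes this walk into a cycle along which P increases
-- except on ts, and the cycle-equation of such a cycle has ts as its only
-- negative coefficient.

module Submission where

open import Defs hiding (sym)
open import Data.Nat as ℕ using (ℕ; zero; suc; z≤n; s≤s)
import Data.Nat.Properties as ℕP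
open import Data.Nat.DivMod using (m<n⇒m%n≡m; n%n≡0)
open import Data.Fin as Fin using (Fin; toℕ; fromℕ; inject₁; _≟_)
import Data.Fin.Properties as FinP
open import Data.Integer as ℤ using (ℤ; 0ℤ; 1ℤ; -1ℤ; +_; _*_; _-_; _+_; -_)
import Data.Integer.Properties as ℤP
open import Data.Integer.Tactic.RingSolver using (solve-∀)
open import Algebra.Properties.Semiring.Sum ℤP.+-*-semiring
  using (sum; sum-syntax; sum-cong-≗; sum-replicate-zero; sum-init-last; ∑-distrib-+; ∑-comm;
         *-distribˡ-sum; *-distribʳ-sum)
import Algebra.Properties.CommutativeMonoid.Sum ℕP.+-0-commutativeMonoid as ℕΣ
open import Data.List using ([]; _∷_; map; tabulate)
open import Data.Product as Product using (Σ; ∃; _×_; _,_; proj₁; proj₂)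
open import Data.Sum as Sum using (_⊎_; inj₁; inj₂)
open import Data.Empty using (⊥-elim)
open import Function using (_∘_)
import Data.Vec.Functional as V
open import Function.Definitions using (Injective)
open import Relation.Binary.PropositionalEquality
open import Relation.Binary.Definitions using (tri<; tri≈; tri>)
open import Relation.Nullary using (¬_; Dec; yes; no; ¬?)
open import Relation.Nullary.Decidable using (_×-dec_; _⊎-dec_; decidable-stable)

Σℤ-tabulate : ∀ {A : Set} n (g : Fin n → A) (f : A → ℤ) → Σℤ (map f (tabulate g)) ≡ sum (f ∘ g)
Σℤ-tabulate zero    g f = refl
Σℤ-tabulate (suc n) g f = cong (_+_ (f (g Fin.zero))) (Σℤ-tabulate n (g ∘ Fin.suc) f)

∑-neg : ∀ {n} (f : Fin n → ℤ) → ∑[ i < n ] (- f i) ≡ - sum f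
∑-neg f = begin
  sum (-_ ∘ f)         ≡⟨ sum-cong-≗ (λ i → sym (ℤP.-1*i≡-i (f i))) ⟩
  sum ((-1ℤ *_) ∘ f)   ≡⟨ *-distribˡ-sum -1ℤ f ⟨
  -1ℤ * sum f          ≡⟨ ℤP.-1*i≡-i (sum f) ⟩
  - sum f              ∎
  where open ≡-Reasoning

∑-distrib-- : ∀ {n} (f g : Fin n → ℤ) → ∑[ i < n ] (f i - g i) ≡ sum f - sum g
∑-distrib-- f g = trans (∑-distrib-+ f (-_ ∘ g)) (cong (_+_ (sum f)) (∑-neg g))

∑-mono-≤ : ∀ {n} {f g : Fin n → ℤ} → (∀ i → f i ℤ.≤ g i) → sum f ℤ.≤ sum g
∑-mono-≤ {zero}  f≤g = ℤP.≤-refl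
∑-mono-≤ {suc n} f≤g = ℤP.+-mono-≤ (f≤g Fin.zero) (∑-mono-≤ (f≤g ∘ Fin.suc))

∑-mono-< : ∀ {n} {f g : Fin n → ℤ} → (∀ i → f i ℤ.≤ g i) → ∀ x → f x ℤ.< g x → sum f ℤ.< sum g
∑-mono-< f≤g Fin.zero    fx<gx = ℤP.+-mono-<-≤ fx<gx (∑-mono-≤ (f≤g ∘ Fin.suc))
∑-mono-< f≤g (Fin.suc x) fx<gx = ℤP.+-mono-≤-< (f≤g Fin.zero) (∑-mono-< (f≤g ∘ Fin.suc) x fx<gx)

∑-nonNeg : ∀ {n} {f : Fin n → ℤ} → (∀ i → 0ℤ ℤ.≤ f i) → 0ℤ ℤ.≤ sum f
∑-nonNeg {n} {f} 0≤f = subst (ℤ._≤ sum f) (sum-replicate-zero n) (∑-mono-≤ 0≤f)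

∑≡0⇒positive : ∀ {n} (f : Fin n → ℤ) {x} → sum f ≡ 0ℤ → f x ℤ.< 0ℤ → ∃ λ w → 0ℤ ℤ.< f w
∑≡0⇒positive {n} f {x} ∑f≡0 fx<0 with FinP.any? (λ w → 0ℤ ℤ.<? f w)
... | yes pos = pos
... | no ¬pos = ⊥-elim (ℤP.<-irrefl (trans ∑f≡0 (sym (sum-replicate-zero n))) ∑f<0)
  where
  ∑f<0 : sum f ℤ.< ∑[ i < n ] 0ℤ
  ∑f<0 = ∑-mono-< (λ w → ℤP.≮⇒≥ (λ 0<fw → ¬pos (w , 0<fw))) x fx<0

∑≢0⇒nonzero : ∀ {n} (f : Fin n → ℤ) → sum f ≢ 0ℤ → ∃ λ i → f i ≢ 0ℤ
∑≢0⇒nonzero {n} f ∑f≢0 with FinP.any? (λ i → ¬? (f i ℤ.≟ 0ℤ))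
... | yes nz = nz
... | no ¬nz = ⊥-elim (∑f≢0 (trans (sum-cong-≗ f≗0) (sum-replicate-zero n)))
  where
  f≗0 : ∀ i → f i ≡ 0ℤ
  f≗0 i = decidable-stable (f i ℤ.≟ 0ℤ) (λ fi≢0 → ¬nz (i , fi≢0))

≤-∑ : ∀ {n} (f : Fin n → ℕ) i → f i ℕ.≤ ℕΣ.sum f
≤-∑ {suc n} f i = subst (f i ℕ.≤_) (sym (ℕΣ.sum-remove f)) (ℕP.m≤m+n (f i) _)

m<n⇒0<+n-+m : ∀ {m n} → m ℕ.< n → 0ℤ ℤ.< + n - + m
m<n⇒0<+n-+m {m} {n} m<n = subst (ℤ._< + n - + m) (ℤP.+-inverseʳ (+ m)) (ℤP.+-monoˡ-< (- + m) (ℤ.+<+ m<n))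

m<n⇒+m-+n<0 : ∀ {m n} → m ℕ.< n → + m - + n ℤ.< 0ℤ
m<n⇒+m-+n<0 {m} {n} m<n = subst (+ m - + n ℤ.<_) (ℤP.+-inverseʳ (+ n)) (ℤP.+-monoˡ-< (- + n) (ℤ.+<+ m<n))

i*j<0⇒i<0 : ∀ {i j} → 0ℤ ℤ.< j → i * j ℤ.< 0ℤ → i ℤ.< 0ℤ
i*j<0⇒i<0 {j = j} 0<j = ℤP.*-cancelʳ-<-nonNeg j {{ℤ.nonNegative (ℤP.<⇒≤ 0<j)}}

0<i⇒j<0⇒i*j<0 : ∀ {i j} → 0ℤ ℤ.< i → j ℤ.< 0ℤ → i * j ℤ.< 0ℤ
0<i⇒j<0⇒i*j<0 {i} {j} 0<i j<0 = subst (i * j ℤ.<_) (ℤP.*-zeroʳ i) (ℤP.*-monoˡ-<-pos i {{ℤ.positive 0<i}} j<0)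

next-inject₁ : ∀ {k} (j : Fin k) → next (inject₁ j) ≡ Fin.suc j
next-inject₁ {k} j = FinP.toℕ-injective (begin
  toℕ (next (inject₁ j))          ≡⟨ FinP.toℕ-fromℕ< _ ⟩
  suc (toℕ (inject₁ j)) ℕ.% suc k ≡⟨ m<n⇒m%n≡m (s≤s j<k) ⟩
  suc (toℕ (inject₁ j))           ≡⟨ cong suc (FinP.toℕ-inject₁ j) ⟩
  suc (toℕ j)                     ∎)
  where
  open ≡-Reasoning
  j<k : toℕ (inject₁ j) ℕ.< k
  j<k = subst (ℕ._< k) (sym (FinP.toℕ-inject₁ j)) (FinP.toℕ<n j)

next-fromℕ : ∀ k → next (fromℕ k) ≡ Fin.zero
next-fromℕ k = FinP.toℕ-injective (begin
  toℕ (next (fromℕ k))          ≡⟨ FinP.toℕ-fromℕ< _ ⟩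
  suc (toℕ (fromℕ k)) ℕ.% suc k ≡⟨ cong (λ i → suc i ℕ.% suc k) (FinP.toℕ-fromℕ k) ⟩
  suc k ℕ.% suc k               ≡⟨ n%n≡0 (suc k) ⟩
  0                             ∎)
  where open ≡-Reasoning

inject₁-or-fromℕ : ∀ {k} (i : Fin (suc k)) → (∃ λ j → i ≡ inject₁ j) ⊎ i ≡ fromℕ k
inject₁-or-fromℕ {zero}  Fin.zero    = inj₂ refl
inject₁-or-fromℕ {suc k} Fin.zero    = inj₁ (Fin.zero , refl)
inject₁-or-fromℕ {suc k} (Fin.suc i) =
  Sum.map (λ { (j , i≡j) → Fin.suc j , cong Fin.suc i≡j }) (cong Fin.suc) (inject₁-or-fromℕ i)

∑-rotate : ∀ {k} (f : Fin (suc k) → ℤ) → sum (f ∘ next) ≡ sum f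
∑-rotate {k} f = begin
  sum (f ∘ next)                           ≡⟨ sum-init-last (f ∘ next) ⟩
  sum (f ∘ next ∘ inject₁) + f (next (fromℕ k))
    ≡⟨ cong₂ _+_ (sum-cong-≗ (cong f ∘ next-inject₁)) (cong f (next-fromℕ k)) ⟩
  sum (f ∘ Fin.suc) + f Fin.zero           ≡⟨ ℤP.+-comm _ (f Fin.zero) ⟩
  sum f                                    ∎
  where open ≡-Reasoning

Ascending : ∀ {k} → (Fin (suc k) → ℕ) → Set
Ascending {k} f = ∀ (j : Fin k) → f (inject₁ j) ℕ.< f (Fin.suc j)

Ascending⇒<-mono : ∀ {k} {f : Fin (suc k) → ℕ} → Ascending f → ∀ {i j} → i Fin.< j → f i ℕ.< f j
Ascending⇒<-mono {suc k} asc {Fin.zero}  {Fin.suc Fin.zero}    _         = asc Fin.zero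
Ascending⇒<-mono {suc k} {f} asc {Fin.zero} {Fin.suc (Fin.suc j)} _       =
  ℕP.<-trans (asc Fin.zero) (Ascending⇒<-mono {f = f ∘ Fin.suc} (asc ∘ Fin.suc) {Fin.zero} {Fin.suc j} (s≤s z≤n))
Ascending⇒<-mono {suc k} {f} asc {Fin.suc i} {Fin.suc j} (s≤s i<j) =
  Ascending⇒<-mono {f = f ∘ Fin.suc} (asc ∘ Fin.suc) i<j

Ascending⇒injective : ∀ {k} {f : Fin (suc k) → ℕ} → Ascending f → Injective _≡_ _≡_ f
Ascending⇒injective asc {i} {j} fi≡fj with FinP.<-cmp i j
... | tri< i<j _ _ = ⊥-elim (ℕP.<⇒≢ (Ascending⇒<-mono asc i<j) fi≡fj)
... | tri≈ _ i≡j _ = i≡j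
... | tri> _ _ j<i = ⊥-elim (ℕP.<⇒≢ (Ascending⇒<-mono asc j<i) (sym fi≡fj))

-- Exactly the proposition decided in [ x , y ≐ a , b ], so that matching on
-- sameEdge? computes the indicator.
SameEdge : ∀ {n} → Fin n → Fin n → Fin n → Fin n → Set
SameEdge x y a b = (x ≡ a × y ≡ b) ⊎ (x ≡ b × y ≡ a)

sameEdge? : ∀ {n} (x y a b : Fin n) → Dec (SameEdge x y a b)
sameEdge? x y a b = ((x ≟ a) ×-dec (y ≟ b)) ⊎-dec ((x ≟ b) ×-dec (y ≟ a))

SameEdge-sym : ∀ {n} {x y a b : Fin n} → SameEdge x y a b → SameEdge a b x y
SameEdge-sym = Sum.map (λ { (refl , refl) → refl , refl }) (λ { (refl , refl) → refl , refl })

SameEdge-trans : ∀ {n} {x y a b u w : Fin n} → SameEdge x y a b → SameEdge a b u w → SameEdge x y u w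
SameEdge-trans (inj₁ (refl , refl)) same = same
SameEdge-trans (inj₂ (refl , refl)) same = Sum.swap (Sum.map Product.swap Product.swap same)

[≐]*-SameEdge : ∀ {n} {x y a b : Fin n} d → SameEdge x y a b → [ x , y ≐ a , b ] * d ≡ d
[≐]*-SameEdge {x = x} {y} {a} {b} d same with sameEdge? x y a b
... | yes _    = ℤP.*-identityˡ d
... | no ¬same = ⊥-elim (¬same same)

[≐]*-¬SameEdge : ∀ {n} {x y a b : Fin n} d → ¬ SameEdge x y a b → [ x , y ≐ a , b ] * d ≡ 0ℤ
[≐]*-¬SameEdge {x = x} {y} {a} {b} d ¬same with sameEdge? x y a b
... | yes same = ⊥-elim (¬same same)
... | no _     = refl

[≐]*-nonNeg : ∀ {n} (x y a b : Fin n) {d} → 0ℤ ℤ.≤ d → 0ℤ ℤ.≤ [ x , y ≐ a , b ] * d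
[≐]*-nonNeg x y a b {d} 0≤d with sameEdge? x y a b
... | yes _ = subst (0ℤ ℤ.≤_) (sym (ℤP.*-identityˡ d)) 0≤d
... | no _  = ℤP.≤-refl

[≐]*<0⇒SameEdge : ∀ {n} (x y a b : Fin n) {d} → [ x , y ≐ a , b ] * d ℤ.< 0ℤ → SameEdge x y a b
[≐]*<0⇒SameEdge x y a b {d} neg with sameEdge? x y a b
... | yes same = same
... | no _     = ⊥-elim (ℤP.<-irrefl refl neg)

module _ {n} (H : Graph n) where

  convex-intro : ∀ (A : Fin n → Fin n → ℤ) x y → E H x y
    → (∀ {a b} → SameEdge a b x y → A a b ℤ.< 0ℤ)
    → (∀ {a b} → E H a b → A a b ℤ.< 0ℤ → SameEdge a b x y)
    → Convex H A
  convex-intro A x y Exy neg onlyNeg with FinP.<-cmp x y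
  ... | tri< x<y _ _ = (x , y) , (x<y , Exy) , neg (inj₁ (refl , refl)) , unique
    where
    unique : ∀ a b → IsEdge H a b → A a b ℤ.< 0ℤ → (a , b) ≡ (x , y)
    unique a b (a<b , Eab) Aab<0 with onlyNeg Eab Aab<0
    ... | inj₁ (refl , refl) = refl
    ... | inj₂ (refl , refl) = ⊥-elim (FinP.<-asym x<y a<b)
  ... | tri≈ _ refl _ = ⊥-elim (irrefl H Exy)
  ... | tri> _ _ y<x = (y , x) , (y<x , Graph.sym H Exy) , neg (inj₂ (refl , refl)) , unique
    where
    unique : ∀ a b → IsEdge H a b → A a b ℤ.< 0ℤ → (a , b) ≡ (y , x)
    unique a b (a<b , Eab) Aab<0 with onlyNeg Eab Aab<0
    ... | inj₁ (refl , refl) = ⊥-elim (FinP.<-asym y<x a<b)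
    ... | inj₂ (refl , refl) = refl

  convex-elim : ∀ {A : Fin n → Fin n → ℤ} → (∀ u w → A w u ≡ A u w) → Convex H A
    → Σ (Fin n × Fin n) λ { (x , y) → E H x y × A x y ℤ.< 0ℤ
        × (∀ {a b} → E H a b → A a b ℤ.< 0ℤ → SameEdge a b x y) }
  convex-elim {A} A-sym ((x , y) , (_ , Exy) , Axy<0 , unique) = (x , y) , Exy , Axy<0 , onlyNeg
    where
    onlyNeg : ∀ {a b} → E H a b → A a b ℤ.< 0ℤ → SameEdge a b x y
    onlyNeg {a} {b} Eab Aab<0 with FinP.<-cmp a b
    ... | tri< a<b _ _ with unique a b (a<b , Eab) Aab<0
    ...   | refl = inj₁ (refl , refl)
    onlyNeg {a} {b} Eab Aab<0 | tri≈ _ refl _ = ⊥-elim (irrefl H Eab)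
    onlyNeg {a} {b} Eab Aab<0 | tri> _ _ b<a
      with unique b a (b<a , Graph.sym H Eab) (subst (ℤ._< 0ℤ) (A-sym b a) Aab<0)
    ...   | refl = inj₂ (refl , refl)

closingEdge-unique : ∀ {n} {H : Graph n} (C : Cycle H) (j : Fin (len C))
  → ¬ SameEdge (vtx C (inject₁ j)) (vtx C (Fin.suc j)) (vtx C (fromℕ (len C))) (vtx C Fin.zero)
closingEdge-unique C j (inj₁ (vⱼ≡vₖ , _)) = FinP.fromℕ≢inject₁ (sym (inj C vⱼ≡vₖ))
closingEdge-unique C j (inj₂ (vⱼ≡v₀ , vⱼ₊₁≡vₖ)) = ℕP.<⇒≢ (len≥3 C) (sym len≡1)
  where
  j≡0 : toℕ j ≡ 0
  j≡0 = trans (sym (FinP.toℕ-inject₁ j)) (cong toℕ (inj C vⱼ≡v₀))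
  len≡1 : len C ≡ 1
  len≡1 = trans (sym (FinP.toℕ-fromℕ (len C))) (trans (cong toℕ (sym (inj C vⱼ₊₁≡vₖ))) (cong suc j≡0))

arcTerm : ∀ {n m} → (Fin n → Fin m) → (Fin m → ℕ) → Fin n → Fin n → Fin n → Fin n → ℤ
arcTerm σ c x y a b = [ x , y ≐ a , b ] * (col σ c y - col σ c x)

module _ {n m} {H : Graph n} (σ : Fin n → Fin m) (c : Fin m → ℕ) where

  pathTerm : (C : Cycle H) → Fin n → Fin n → Fin (len C) → ℤ
  pathTerm C a b j = arcTerm σ c (vtx C (inject₁ j)) (vtx C (Fin.suc j)) a b

  closingTerm : Cycle H → Fin n → Fin n → ℤ
  closingTerm C a b = arcTerm σ c (vtx C (fromℕ (len C))) (vtx C Fin.zero) a b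

  cycCoeff-init-last : ∀ (C : Cycle H) a b → cycCoeff σ c C a b ≡ sum (pathTerm C a b) + closingTerm C a b
  cycCoeff-init-last C a b = begin
    cycCoeff σ c C a b                     ≡⟨ Σℤ-tabulate (suc k) (λ i → i) term ⟩
    sum term                               ≡⟨ sum-init-last term ⟩
    sum (term ∘ inject₁) + term (fromℕ k)
      ≡⟨ cong₂ _+_ (sum-cong-≗ (λ j → cong (λ i → arcTerm σ c (v (inject₁ j)) (v i) a b) (next-inject₁ j)))
                   (cong (λ i → arcTerm σ c (v (fromℕ k)) (v i) a b) (next-fromℕ k)) ⟩
    sum (pathTerm C a b) + closingTerm C a b ∎
    where
    open ≡-Reasoning
    k = len C
    v = vtx C
    term : Fin (suc k) → ℤ
    term i = arcTerm σ c (v i) (v (next i)) a b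

  module _ (C : Cycle H) (asc : Ascending (λ i → c (σ (vtx C i)))) where

    private
      k = len C
      v = vtx C

    pathTerm-nonNeg : ∀ a b j → 0ℤ ℤ.≤ pathTerm C a b j
    pathTerm-nonNeg a b j = [≐]*-nonNeg (v (inject₁ j)) (v (Fin.suc j)) a b (ℤP.<⇒≤ (m<n⇒0<+n-+m (asc j)))

    closingEdge-descends : col σ c (v Fin.zero) - col σ c (v (fromℕ k)) ℤ.< 0ℤ
    closingEdge-descends = m<n⇒+m-+n<0 (Ascending⇒<-mono {f = λ i → c (σ (v i))} asc {Fin.zero} {fromℕ k}
      (subst (0 ℕ.<_) (sym (FinP.toℕ-fromℕ k)) (ℕP.<-≤-trans (s≤s z≤n) (len≥3 C))))

    closingEdge-negative : ∀ {a b} → SameEdge a b (v (fromℕ k)) (v Fin.zero) → cycCoeff σ c C a b ℤ.< 0ℤ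
    closingEdge-negative {a} {b} same = begin-strict
      cycCoeff σ c C a b
        ≡⟨ cycCoeff-init-last C a b ⟩
      sum (pathTerm C a b) + closingTerm C a b
        ≡⟨ cong₂ _+_ (trans (sum-cong-≗ pathTerm≡0) (sum-replicate-zero k)) ([≐]*-SameEdge _ (SameEdge-sym same)) ⟩
      0ℤ + (col σ c (v Fin.zero) - col σ c (v (fromℕ k)))
        ≡⟨ ℤP.+-identityˡ _ ⟩
      col σ c (v Fin.zero) - col σ c (v (fromℕ k))
        <⟨ closingEdge-descends ⟩
      0ℤ ∎
      where
      open ℤP.≤-Reasoning
      pathTerm≡0 : ∀ j → pathTerm C a b j ≡ 0ℤ
      pathTerm≡0 j = [≐]*-¬SameEdge _ (λ sameⱼ → closingEdge-unique C j (SameEdge-trans sameⱼ same))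

    negative⇒closingEdge : ∀ {a b} → cycCoeff σ c C a b ℤ.< 0ℤ → SameEdge a b (v (fromℕ k)) (v Fin.zero)
    negative⇒closingEdge {a} {b} Cab<0 = SameEdge-sym ([≐]*<0⇒SameEdge (v (fromℕ k)) (v Fin.zero) a b closing<0)
      where
      closing<0 : closingTerm C a b ℤ.< 0ℤ
      closing<0 = ℤP.≰⇒> λ 0≤closing → ℤP.<⇒≱ (subst (ℤ._< 0ℤ) (cycCoeff-init-last C a b) Cab<0)
        (ℤP.+-mono-≤ (∑-nonNeg (pathTerm-nonNeg a b)) 0≤closing)

    Ascending⇒convex : Convex H (cycCoeff σ c C)
    Ascending⇒convex = convex-intro H (cycCoeff σ c C) (v (fromℕ k)) (v Fin.zero)
      (subst (E H _) (cong v (next-fromℕ k)) (adj C (fromℕ k)))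
      closingEdge-negative (λ _ → negative⇒closingEdge)

δ : ∀ {n} → Fin n → Fin n → ℤ
δ Fin.zero    Fin.zero    = 1ℤ
δ Fin.zero    (Fin.suc _) = 0ℤ
δ (Fin.suc _) Fin.zero    = 0ℤ
δ (Fin.suc x) (Fin.suc y) = δ x y

δ-refl : ∀ {n} (x : Fin n) → δ x x ≡ 1ℤ
δ-refl Fin.zero    = refl
δ-refl (Fin.suc x) = δ-refl x

δ-≢ : ∀ {n} {x y : Fin n} → x ≢ y → δ x y ≡ 0ℤ
δ-≢ {x = Fin.zero}  {Fin.zero}  x≢y = ⊥-elim (x≢y refl)
δ-≢ {x = Fin.zero}  {Fin.suc _} _   = refl
δ-≢ {x = Fin.suc _} {Fin.zero}  _   = refl
δ-≢ {x = Fin.suc x} {Fin.suc y} x≢y = δ-≢ (x≢y ∘ cong Fin.suc)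

∑-δ : ∀ {n} (x : Fin n) → sum (δ x) ≡ 1ℤ
∑-δ {suc n} Fin.zero    = cong (_+_ 1ℤ) (sum-replicate-zero n)
∑-δ         (Fin.suc x) = trans (ℤP.+-identityˡ _) (∑-δ x)

arcFlow : ∀ {n} → Fin n → Fin n → Fin n → Fin n → ℤ
arcFlow x y u w = δ x u * δ y w - δ x w * δ y u

arcFlow-antisym : ∀ {n} (x y u w : Fin n) → arcFlow x y w u ≡ - arcFlow x y u w
arcFlow-antisym x y u w = swap-difference (δ x w) (δ y u) (δ x u) (δ y w)
  where
  swap-difference : ∀ a b c d → a * b - c * d ≡ - (c * d - a * b)
  swap-difference = solve-∀

∑-arcFlow : ∀ {n} (x y u : Fin n) → ∑[ w < n ] arcFlow x y u w ≡ δ x u - δ y u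
∑-arcFlow {n} x y u = begin
  ∑[ w < n ] (δ x u * δ y w - δ x w * δ y u)
    ≡⟨ ∑-distrib-- (λ w → δ x u * δ y w) (λ w → δ x w * δ y u) ⟩
  ∑[ w < n ] (δ x u * δ y w) - ∑[ w < n ] (δ x w * δ y u)
    ≡⟨ cong₂ _-_ (sym (*-distribˡ-sum (δ x u) (δ y))) (sym (*-distribʳ-sum (δ y u) (δ x))) ⟩
  δ x u * sum (δ y) - sum (δ x) * δ y u
    ≡⟨ cong₂ _-_ (cong (δ x u *_) (∑-δ y)) (cong (_* δ y u) (∑-δ x)) ⟩
  δ x u * 1ℤ - 1ℤ * δ y u
    ≡⟨ cong₂ _-_ (ℤP.*-identityʳ (δ x u)) (ℤP.*-identityˡ (δ y u)) ⟩
  δ x u - δ y u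
    ∎
  where open ≡-Reasoning

arcFlow-¬SameEdge : ∀ {n} {x y u w : Fin n} → ¬ SameEdge x y u w → arcFlow x y u w ≡ 0ℤ
arcFlow-¬SameEdge {x = x} {y} {u} {w} ¬same = cong₂ _-_ (δδ≡0 (¬same ∘ inj₁)) (δδ≡0 (¬same ∘ inj₂))
  where
  δδ≡0 : ∀ {a b} → ¬ (x ≡ a × y ≡ b) → δ x a * δ y b ≡ 0ℤ
  δδ≡0 {a} {b} ¬eq with x ≟ a
  ... | yes x≡a = trans (cong (δ x a *_) (δ-≢ (λ y≡b → ¬eq (x≡a , y≡b)))) (ℤP.*-zeroʳ (δ x a))
  ... | no x≢a  = trans (cong (_* δ y b) (δ-≢ x≢a)) (ℤP.*-zeroˡ (δ y b))

arcFlow≢0⇒SameEdge : ∀ {n} {x y u w : Fin n} → arcFlow x y u w ≢ 0ℤ → SameEdge x y u w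
arcFlow≢0⇒SameEdge {x = x} {y} {u} {w} nz with sameEdge? x y u w
... | yes same = same
... | no ¬same = ⊥-elim (nz (arcFlow-¬SameEdge ¬same))

arcTerm≡arcFlow* : ∀ {n} (P : Fin n → ℤ) {x y : Fin n} u w → x ≢ y
  → [ x , y ≐ u , w ] * (P y - P x) ≡ arcFlow x y u w * (P w - P u)
arcTerm≡arcFlow* P {x} {y} u w x≢y with sameEdge? x y u w
... | yes (inj₁ (refl , refl)) = cong (_* _) (sym forward)
  where
  forward : arcFlow x y x y ≡ 1ℤ
  forward = cong₂ _-_ (cong₂ _*_ (δ-refl x) (δ-refl y)) (cong₂ _*_ (δ-≢ x≢y) (δ-≢ (x≢y ∘ sym)))
... | yes (inj₂ (refl , refl)) = trans (reverse (P x) (P y)) (cong (_* _) (sym backward))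
  where
  backward : arcFlow x y y x ≡ -1ℤ
  backward = cong₂ _-_ (cong₂ _*_ (δ-≢ x≢y) (δ-≢ (x≢y ∘ sym))) (cong₂ _*_ (δ-refl x) (δ-refl y))
  reverse : ∀ a b → 1ℤ * (b - a) ≡ -1ℤ * (a - b)
  reverse = solve-∀
... | no ¬same = sym (trans (cong (_* (P w - P u)) (arcFlow-¬SameEdge ¬same)) (ℤP.*-zeroˡ (P w - P u)))

record IsCirculation {n} (H : Graph n) (φ : Fin n → Fin n → ℤ) : Set where
  field
    antisym   : ∀ u w → φ w u ≡ - φ u w
    conserved : ∀ u → sum (φ u) ≡ 0ℤ
    supported : ∀ {u w} → φ u w ≢ 0ℤ → E H u w

module _ {n} {H : Graph n} where

  cycleFlow : Cycle H → Fin n → Fin n → ℤ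
  cycleFlow C u w = ∑[ i < suc (len C) ] arcFlow (vtx C i) (vtx C (next i)) u w

  cycleFlow-isCirculation : (C : Cycle H) → IsCirculation H (cycleFlow C)
  cycleFlow-isCirculation C = record
    { antisym   = λ u w → trans (sum-cong-≗ (λ i → arcFlow-antisym (v i) (v (next i)) u w))
                                (∑-neg (λ i → arcFlow (v i) (v (next i)) u w))
    ; conserved = conserved
    ; supported = supported
    }
    where
    ℓ = suc (len C)
    v = vtx C
    conserved : ∀ u → sum (cycleFlow C u) ≡ 0ℤ
    conserved u = begin
      ∑[ w < n ] ∑[ i < ℓ ] arcFlow (v i) (v (next i)) u w
        ≡⟨ ∑-comm (λ i w → arcFlow (v i) (v (next i)) u w) ⟨
      ∑[ i < ℓ ] ∑[ w < n ] arcFlow (v i) (v (next i)) u w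
        ≡⟨ sum-cong-≗ (λ i → ∑-arcFlow (v i) (v (next i)) u) ⟩
      ∑[ i < ℓ ] (visits i - visits (next i))
        ≡⟨ ∑-distrib-- visits (visits ∘ next) ⟩
      sum visits - sum (visits ∘ next)
        ≡⟨ cong (_-_ (sum visits)) (∑-rotate visits) ⟩
      sum visits - sum visits
        ≡⟨ ℤP.+-inverseʳ (sum visits) ⟩
      0ℤ
        ∎
      where
      open ≡-Reasoning
      visits : Fin ℓ → ℤ
      visits i = δ (v i) u
    supported : ∀ {u w} → cycleFlow C u w ≢ 0ℤ → E H u w
    supported {u} {w} nz with ∑≢0⇒nonzero (λ i → arcFlow (v i) (v (next i)) u w) nz
    ... | i , arc≢0 with arcFlow≢0⇒SameEdge {x = v i} {v (next i)} arc≢0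
    ...   | inj₁ (refl , refl) = adj C i
    ...   | inj₂ (refl , refl) = Graph.sym H (adj C i)

  combFlow : LinComb H → Fin n → Fin n → ℤ
  combFlow []            u w = 0ℤ
  combFlow ((k , C) ∷ L) u w = k * cycleFlow C u w + combFlow L u w

  IsCirculation-zero : IsCirculation H (λ _ _ → 0ℤ)
  IsCirculation-zero = record
    { antisym   = λ _ _ → refl
    ; conserved = λ _ → sum-replicate-zero n
    ; supported = λ 0≢0 → ⊥-elim (0≢0 refl)
    }

  IsCirculation-linear : ∀ {φ ψ} k → IsCirculation H φ → IsCirculation H ψ
    → IsCirculation H (λ u w → k * φ u w + ψ u w)
  IsCirculation-linear {φ} {ψ} k φ-circ ψ-circ = record
    { antisym   = λ u w → trans (cong₂ (λ a b → k * a + b) (Φ.antisym u w) (Ψ.antisym u w))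
                                (linear-neg k (φ u w) (ψ u w))
    ; conserved = conserved
    ; supported = supported
    }
    where
    module Φ = IsCirculation φ-circ
    module Ψ = IsCirculation ψ-circ
    linear-neg : ∀ k a b → k * (- a) + (- b) ≡ - (k * a + b)
    linear-neg = solve-∀
    conserved : ∀ u → ∑[ w < n ] (k * φ u w + ψ u w) ≡ 0ℤ
    conserved u = begin
      ∑[ w < n ] (k * φ u w + ψ u w)          ≡⟨ ∑-distrib-+ (λ w → k * φ u w) (ψ u) ⟩
      ∑[ w < n ] (k * φ u w) + sum (ψ u)      ≡⟨ cong₂ _+_ (sym (*-distribˡ-sum k (φ u))) (Ψ.conserved u) ⟩
      k * sum (φ u) + 0ℤ                      ≡⟨ cong (λ s → k * s + 0ℤ) (Φ.conserved u) ⟩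
      k * 0ℤ + 0ℤ                             ≡⟨ cong (_+ 0ℤ) (ℤP.*-zeroʳ k) ⟩
      0ℤ                                      ∎
      where open ≡-Reasoning
    supported : ∀ {u w} → k * φ u w + ψ u w ≢ 0ℤ → E H u w
    supported {u} {w} nz with φ u w ℤ.≟ 0ℤ
    ... | no φuw≢0 = Φ.supported φuw≢0
    ... | yes φuw≡0 = Ψ.supported λ ψuw≡0 → nz (begin
      k * φ u w + ψ u w    ≡⟨ cong₂ (λ a b → k * a + b) φuw≡0 ψuw≡0 ⟩
      k * 0ℤ + 0ℤ          ≡⟨ cong (_+ 0ℤ) (ℤP.*-zeroʳ k) ⟩
      0ℤ                   ∎)
      where open ≡-Reasoning

  combFlow-isCirculation : (L : LinComb H) → IsCirculation H (combFlow L)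
  combFlow-isCirculation []            = IsCirculation-zero
  combFlow-isCirculation ((k , C) ∷ L) =
    IsCirculation-linear k (cycleFlow-isCirculation C) (combFlow-isCirculation L)

module _ {n m} {H : Graph n} (σ : Fin n → Fin m) (c : Fin m → ℕ) where

  private
    Δ : Fin n → Fin n → ℤ
    Δ u w = col σ c w - col σ c u

  cycCoeff≡cycleFlow* : ∀ (C : Cycle H) u w → cycCoeff σ c C u w ≡ cycleFlow C u w * Δ u w
  cycCoeff≡cycleFlow* C u w = begin
    cycCoeff σ c C u w
      ≡⟨ Σℤ-tabulate (suc (len C)) (λ i → i) (λ i → arcTerm σ c (v i) (v (next i)) u w) ⟩
    ∑[ i < suc (len C) ] arcTerm σ c (v i) (v (next i)) u w
      ≡⟨ sum-cong-≗ (λ i → arcTerm≡arcFlow* (col σ c) u w (loopless i)) ⟩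
    ∑[ i < suc (len C) ] (arcFlow (v i) (v (next i)) u w * Δ u w)
      ≡⟨ *-distribʳ-sum (Δ u w) (λ i → arcFlow (v i) (v (next i)) u w) ⟨
    cycleFlow C u w * Δ u w                         ∎
    where
    open ≡-Reasoning
    v = vtx C
    loopless : ∀ i → v i ≢ v (next i)
    loopless i vᵢ≡vᵢ₊₁ = irrefl H (subst (E H _) (sym vᵢ≡vᵢ₊₁) (adj C i))

  combCoeff≡combFlow* : ∀ (L : LinComb H) u w → combCoeff σ c L u w ≡ combFlow L u w * Δ u w
  combCoeff≡combFlow* []            u w = sym (ℤP.*-zeroˡ (Δ u w))
  combCoeff≡combFlow* ((k , C) ∷ L) u w = begin
    k * cycCoeff σ c C u w + combCoeff σ c L u w
      ≡⟨ cong₂ (λ a b → k * a + b) (cycCoeff≡cycleFlow* C u w) (combCoeff≡combFlow* L u w) ⟩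
    k * (cycleFlow C u w * Δ u w) + combFlow L u w * Δ u w
      ≡⟨ factor k (cycleFlow C u w) (combFlow L u w) (Δ u w) ⟩
    (k * cycleFlow C u w + combFlow L u w) * Δ u w  ∎
    where
    open ≡-Reasoning
    factor : ∀ k a b d → k * (a * d) + b * d ≡ (k * a + b) * d
    factor = solve-∀

record Path {A : Set} (R : A → A → Set) (s t : A) : Set where
  field
    len   : ℕ
    vtx   : Fin (suc len) → A
    start : vtx Fin.zero ≡ s
    end   : vtx (fromℕ len) ≡ t
    steps : ∀ j → R (vtx (inject₁ j)) (vtx (Fin.suc j))

module _ {A : Set} {R : A → A → Set} where

  ε : ∀ {t} → Path R t t
  ε {t} = record { len = 0 ; vtx = λ _ → t ; start = refl ; end = refl ; steps = λ () }

  infixr 5 _◅_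
  _◅_ : ∀ {u w t} → R u w → Path R w t → Path R u t
  _◅_ {u} r π = record
    { len   = suc (Path.len π)
    ; vtx   = u V.∷ Path.vtx π
    ; start = refl
    ; end   = Path.end π
    ; steps = λ { Fin.zero → subst (R u) (sym (Path.start π)) r ; (Fin.suc j) → Path.steps π j }
    }

  Path-len≥2 : ∀ {s t} → s ≢ t → ¬ R s t → (π : Path R s t) → 2 ℕ.≤ Path.len π
  Path-len≥2 s≢t _ record { len = zero ; start = refl ; end = refl } = ⊥-elim (s≢t refl)
  Path-len≥2 _ ¬Rst record { len = suc zero ; start = refl ; end = refl ; steps = steps } =
    ⊥-elim (¬Rst (steps Fin.zero))
  Path-len≥2 _ _ record { len = suc (suc _) } = s≤s (s≤s z≤n)

module _ {n} {H : Graph n} (p : Fin n → ℕ) where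

  closePath : ∀ {R : Fin n → Fin n → Set} {s t} → (∀ {u w} → R u w → E H u w × p u ℕ.< p w)
    → (π : Path R s t) → E H t s → 2 ℕ.≤ Path.len π
    → Σ (Cycle H) λ C → Ascending (p ∘ vtx C)
  closePath {R} {s} {t} R⇒ascent π Ets 2≤len = C , ascending
    where
    k = Path.len π
    v = Path.vtx π
    ascending : Ascending (p ∘ v)
    ascending j = proj₂ (R⇒ascent (Path.steps π j))
    adjacent : ∀ i → E H (v i) (v (next i))
    adjacent i with inject₁-or-fromℕ i
    ... | inj₁ (j , refl) = subst (E H _) (cong v (sym (next-inject₁ j))) (proj₁ (R⇒ascent (Path.steps π j)))
    ... | inj₂ refl       =
      subst₂ (E H) (sym (Path.end π)) (trans (sym (Path.start π)) (cong v (sym (next-fromℕ k)))) Ets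
    C : Cycle H
    C = record
      { len   = k
      ; len≥3 = 2≤len
      ; vtx   = v
      ; inj   = Ascending⇒injective ascending ∘ cong p
      ; adj   = adjacent
      }

module _ {n} {H : Graph n} {φ : Fin n → Fin n → ℤ} (circ : IsCirculation H φ) (p : Fin n → ℕ) where

  open IsCirculation circ

  Uphill : Fin n → Fin n → Set
  Uphill u w = 0ℤ ℤ.< φ u w × p u ℕ.< p w

  -- p increases along each step and is bounded by ∑ p, which bounds the fuel.
  uphillPath : ∀ {s t} → (∀ {u w} → u ≢ t → 0ℤ ℤ.< φ u w → p u ℕ.< p w)
    → φ s t ℤ.< 0ℤ → Path Uphill s t
  uphillPath {s} {t} up φst<0 = go (suc height) s (ℕP.m≤n+m (suc height) (p s)) (t , φst<0)
    where
    height = ℕΣ.sum p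
    go : ∀ fuel u → height ℕ.< p u ℕ.+ fuel → (∃ λ x → φ u x ℤ.< 0ℤ) → Path Uphill u t
    go zero u h<pu _ = ⊥-elim (ℕP.<⇒≱ (subst (height ℕ.<_) (ℕP.+-identityʳ (p u)) h<pu) (≤-∑ p u))
    go (suc fuel) u h<pu+fuel (x , φux<0) with u ≟ t
    ... | yes refl = ε
    ... | no u≢t with ∑≡0⇒positive (φ u) (conserved u) φux<0
    ...   | w , φuw>0 = (φuw>0 , pu<pw) ◅ go fuel w h<pw+fuel (u , φwu<0)
      where
      pu<pw = up u≢t φuw>0
      h<pw+fuel : height ℕ.< p w ℕ.+ fuel
      h<pw+fuel = ℕP.<-≤-trans (subst (height ℕ.<_) (ℕP.+-suc (p u) fuel) h<pu+fuel) (ℕP.+-monoˡ-≤ fuel pu<pw)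
      φwu<0 : φ w u ℤ.< 0ℤ
      φwu<0 = subst (ℤ._< 0ℤ) (sym (antisym u w)) (ℤP.neg-mono-< φuw>0)

  module _ (distinct : ∀ {u w} → E H u w → p u ≢ p w)
           {A : Fin n → Fin n → ℤ} (A≡φΔ : ∀ u w → A u w ≡ φ u w * (+ p w - + p u)) where

    A-sym : ∀ u w → A w u ≡ A u w
    A-sym u w = begin
      A w u                           ≡⟨ A≡φΔ w u ⟩
      φ w u * (+ p u - + p w)         ≡⟨ cong (_* (+ p u - + p w)) (antisym u w) ⟩
      - φ u w * (+ p u - + p w)       ≡⟨ neg-flip (φ u w) (+ p u) (+ p w) ⟩
      φ u w * (+ p w - + p u)         ≡⟨ A≡φΔ u w ⟨
      A u w                           ∎
      where
      open ≡-Reasoning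
      neg-flip : ∀ a b c → - a * (b - c) ≡ a * (c - b)
      neg-flip = solve-∀

    ascendingCycleThrough : ∀ {s t} → E H s t → p s ℕ.< p t → A s t ℤ.< 0ℤ
      → (∀ {u w} → E H u w → A u w ℤ.< 0ℤ → SameEdge u w s t)
      → Σ (Cycle H) λ C → Ascending (p ∘ vtx C)
    ascendingCycleThrough {s} {t} Est ps<pt Ast<0 onlyNeg =
      closePath p uphill⇒ascent path (Graph.sym H Est)
        (Path-len≥2 s≢t (λ (φst>0 , _) → ℤP.<-asym φst>0 φst<0) path)
      where
      φst<0 : φ s t ℤ.< 0ℤ
      φst<0 = i*j<0⇒i<0 (m<n⇒0<+n-+m ps<pt) (subst (ℤ._< 0ℤ) (A≡φΔ s t) Ast<0)
      s≢t : s ≢ t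
      s≢t refl = ℕP.<-irrefl refl ps<pt
      up : ∀ {u w} → u ≢ t → 0ℤ ℤ.< φ u w → p u ℕ.< p w
      up {u} {w} u≢t φuw>0 with ℕP.<-cmp (p u) (p w)
      ... | tri< pu<pw _ _ = pu<pw
      ... | tri≈ _ pu≡pw _ = ⊥-elim (distinct (supported (≢-sym (ℤP.<⇒≢ φuw>0))) pu≡pw)
      ... | tri> _ _ pw<pu
        with onlyNeg (supported (≢-sym (ℤP.<⇒≢ φuw>0)))
                     (subst (ℤ._< 0ℤ) (sym (A≡φΔ u w)) (0<i⇒j<0⇒i*j<0 φuw>0 (m<n⇒+m-+n<0 pw<pu)))
      ...   | inj₁ (refl , refl) = ⊥-elim (ℤP.<-asym φuw>0 φst<0)
      ...   | inj₂ (u≡t , _)     = ⊥-elim (u≢t u≡t)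
      path = uphillPath up φst<0
      uphill⇒ascent : ∀ {u w} → Uphill u w → E H u w × p u ℕ.< p w
      uphill⇒ascent (φuw>0 , pu<pw) = supported (≢-sym (ℤP.<⇒≢ φuw>0)) , pu<pw

    ascendingCycle : Convex H A → Σ (Cycle H) λ C → Ascending (p ∘ vtx C)
    ascendingCycle convex with convex-elim H A-sym convex
    ... | (x , y) , Exy , Axy<0 , onlyNeg with ℕP.<-cmp (p x) (p y)
    ...   | tri< px<py _ _ = ascendingCycleThrough Exy px<py Axy<0 onlyNeg
    ...   | tri≈ _ px≡py _ = ⊥-elim (distinct Exy px≡py)
    ...   | tri> _ _ py<px = ascendingCycleThrough (Graph.sym H Exy) py<px
                               (subst (ℤ._< 0ℤ) (sym (A-sym x y)) Axy<0) (λ Euw Auw<0 → Sum.swap (onlyNeg Euw Auw<0))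

lemma4p1 : ∀ {n m} (F : Graph m) (H : Graph n) (σ : Fin n → Fin m)
    → IsHom H F σ
    → (c : Fin m → ℕ) → (∀ x → 0 ℕ.< c x) → Injective _≡_ _≡_ c
    → (L : LinComb H) → Convex H (combCoeff σ c L)
    → Σ (Cycle H) (λ C → Convex H (cycCoeff σ c C))
lemma4p1 F H σ hom c _ c-inj L convex =
  Product.map₂ (λ {C} → Ascending⇒convex σ c C)
    (ascendingCycle (combFlow-isCirculation L) (c ∘ σ) distinct (combCoeff≡combFlow* σ c L) convex)
  where
  distinct : ∀ {u w} → E H u w → c (σ u) ≢ c (σ w)
  distinct {u} Euw cσu≡cσw = irrefl F (subst (E F (σ u)) (sym (c-inj cσu≡cσw)) (hom Euw))
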